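{- Let $m\geq 2$ be an integer. Then for $1\le j\le m$, \[ d_{j-1}(m)\le \frac{2(m+1)B(m,j)-(4m+2j+3)}{2(m+j)}\,d_j(m), \] where \[ B(m,j)=\frac{A(m,j)}{2(j+2)(4m+2j+5)(m+1)(m-j+1)}, \] \[ A(m,j)=30+96m^2+94m+37j+72m^2j+8m^2j^2-j^3+99mj+5j^2+13mj^2+16m^3j+32m^3. \]
   Context: For a nonnegative integer $m$ and $0\le i\le m$, the Boros-Moll coefficients are \[ d_i(m)=2^{ -2m}\sum_{k=i}^m 2^k\binom{2m-2k}{m-k}\binom{m+k}{k}\binom{k}{i}. \] -}

module Defs where

open import Data.Nat as ℕ using (ℕ; zero; suc; _∸_)
open import Data.Nat.Combinatorics using (_C_)
open import Data.List using (List; map; upTo)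
open import Data.Nat.ListAction using (sum)
open import Data.Integer as ℤ using (ℤ; +_)
open import Data.Rational as ℚ using (ℚ; _/_)

-- Σ_{k = a}^{b} f k  (empty when b < a)
sumFromTo : ℕ → ℕ → (ℕ → ℕ) → ℕ
sumFromTo a b f = sum (map (λ t → f (a ℕ.+ t)) (upTo (suc b ∸ a)))

-- integer numerator divided by a natural denominator, as a rational;
-- division by zero returns 0 (never used: all denominators below are positive)
infixl 7 _/ₙ_
_/ₙ_ : ℤ → ℕ → ℚ
p /ₙ zero = ℚ.0ℚ
p /ₙ suc n = p / suc n

-- Boros–Moll coefficient d_i(m) = 2^{-2m} Σ_{k=i}^m 2^k C(2m-2k,m-k) C(m+k,k) C(k,i)
d : ℕ → ℕ → ℚ
d i m = ((+ 1) /ₙ (2 ℕ.^ (2 ℕ.* m))) ℚ.*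
        ((+ (sumFromTo i m (λ k → 2 ℕ.^ k ℕ.* ((2 ℕ.* m ∸ 2 ℕ.* k) C (m ∸ k))
                                   ℕ.* ((m ℕ.+ k) C k) ℕ.* (k C i)))) /ₙ 1)

A : ℕ → ℕ → ℤ
A m j = let M = + m ; J = + j in
  + 30 ℤ.+ + 96 ℤ.* M ℤ.* M ℤ.+ + 94 ℤ.* M ℤ.+ + 37 ℤ.* J
  ℤ.+ + 72 ℤ.* M ℤ.* M ℤ.* J ℤ.+ + 8 ℤ.* M ℤ.* M ℤ.* J ℤ.* J
  ℤ.- J ℤ.* J ℤ.* J ℤ.+ + 99 ℤ.* M ℤ.* J ℤ.+ + 5 ℤ.* J ℤ.* J
  ℤ.+ + 13 ℤ.* M ℤ.* J ℤ.* J ℤ.+ + 16 ℤ.* M ℤ.* M ℤ.* M ℤ.* J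
  ℤ.+ + 32 ℤ.* M ℤ.* M ℤ.* M

-- B(m,j) = A(m,j) / (2 (j+2) (4m+2j+5) (m+1) (m-j+1))   (used with j ≤ m)
B : ℕ → ℕ → ℚ
B m j = (A m j) /ₙ (2 ℕ.* (j ℕ.+ 2) ℕ.* (4 ℕ.* m ℕ.+ 2 ℕ.* j ℕ.+ 5)
                  ℕ.* (m ℕ.+ 1) ℕ.* (m ∸ j ℕ.+ 1))

coeff : ℕ → ℕ → ℚ
coeff m j = (((+ (2 ℕ.* (m ℕ.+ 1))) /ₙ 1) ℚ.* B m j
              ℚ.- ((+ (4 ℕ.* m ℕ.+ 2 ℕ.* j ℕ.+ 3)) /ₙ 1))
            ℚ.* ((+ 1) /ₙ (2 ℕ.* (m ℕ.+ j)))

module Submission where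

-- Write 4^m d_i(m) = Σ_k T(m,k) C(k,i) with T(m,k) = 2^k C(2m-2k,m-k) C(m+k,k).
-- Zeilberger's method gives the three-term recurrence
--   (m+i)(m+1-i) d_{i-1}(m) + i(i+1) d_{i+1}(m) = i(2m+1) d_i(m),
-- certified by a telescoping sum. With j = a+1 and m = j+t the coefficient of the
-- theorem equals ν(a,t)/δ(a,t) for polynomials ν, δ with nonnegative coefficients.
-- The bound d_{j-1}(m) ≤ (ν/δ) d_j(m) then follows by downward induction on j,
-- starting at j = m: the recurrence turns the bound for j+1 into the bound for j
-- as soon as a polynomial inequality holds, and its slack σ(a,t) again has
-- nonnegative coefficients.

open import Defs
open import Data.Nat using (ℕ; _≤_; _∸_)
open import Data.Rational using (ℚ) renaming (_≤_ to _≤ℚ_; _*_ to _*ℚ_)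

open import Data.Nat using (zero; suc; _+_; _*_; _^_; _<_; _≡ᵇ_; z≤n; s≤s; s≤s⁻¹; NonZero)
open import Data.Nat.Properties
open import Data.Nat.Combinatorics using (_C_; nCk+nC[k+1]≡[n+1]C[k+1]; nCk≡nC[n∸k]; nC1≡n)
open import Data.Nat.Combinatorics.Specification using (k>n⇒nCk≡0)
open import Data.Nat.ListAction using (sum)
open import Data.Nat.ListAction.Properties using (sum-++)
open import Data.Nat.Tactic.RingSolver using (solve-∀)
open import Data.List using (List; []; _∷_; upTo; _∷ʳ_)
import Data.List as List
open import Data.List.Properties using (upTo-∷ʳ; map-++)
open import Data.Vec using (Vec; []; _∷_; lookup)
import Data.Vec as Vec
open import Data.Vec.Properties using (lookup-map)
import Data.Fin as Fin
open Fin using (Fin)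
open import Data.Bool using (Bool; true; _∧_; T)
open import Data.Bool.Properties using (T-∧)
open import Data.Product using (_,_; proj₁; proj₂)
open import Function.Bundles using (Equivalence)
import Data.Integer as ℤ
open ℤ using (ℤ; +_)
import Data.Integer.Properties as ℤ
import Data.Integer.Tactic.RingSolver as ℤ-Solver
open import Data.Integer.GCD using (gcd)
open import Data.Rational as ℚ using (toℚᵘ; ↥_; ↧_)
open import Data.Rational.Properties
  using (↥-/; ↧-/; ↥ᵘ-toℚᵘ; ↧ᵘ-toℚᵘ; toℚᵘ-homo-*; toℚᵘ-homo-+; toℚᵘ-homo‿-; toℚᵘ-cancel-≤)
open import Data.Rational.Unnormalised as ℚᵘ using (*≡*; *≤*)
  renaming (_/_ to _/ᵘ_; _≃_ to _≃ᵘ_; _≤_ to _≤ᵘ_)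
import Data.Rational.Unnormalised.Properties as ℚᵘ
open import Algebra.Properties.CommutativeSemigroup *-commutativeSemigroup using (x∙yz≈y∙xz)
open import Relation.Binary.PropositionalEquality

[k+1]*[n+1]C[k+1]≡[n+1]*nCk : ∀ n k → suc k * (suc n C suc k) ≡ suc n * (n C k)
[k+1]*[n+1]C[k+1]≡[n+1]*nCk zero zero = refl
[k+1]*[n+1]C[k+1]≡[n+1]*nCk zero (suc k) =
  trans (cong (suc (suc k) *_) (k>n⇒nCk≡0 {1} {suc (suc k)} (s≤s (s≤s z≤n))))
        (trans (*-zeroʳ (suc (suc k))) (sym (cong (1 *_) (k>n⇒nCk≡0 {0} {suc k} (s≤s z≤n)))))
[k+1]*[n+1]C[k+1]≡[n+1]*nCk (suc n) zero = trans (+-identityʳ _) (trans (nC1≡n (suc (suc n))) (sym (*-identityʳ _)))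
[k+1]*[n+1]C[k+1]≡[n+1]*nCk (suc n) (suc k) = begin
  suc (suc k) * (suc (suc n) C suc (suc k))
    ≡⟨ cong (suc (suc k) *_) (sym (nCk+nC[k+1]≡[n+1]C[k+1] (suc n) (suc k))) ⟩
  suc (suc k) * (suc n C suc k + suc n C suc (suc k))
    ≡⟨ lemma (suc k) (suc n C suc k) (suc n C suc (suc k)) ⟩
  suc k * (suc n C suc k) + suc n C suc k + suc (suc k) * (suc n C suc (suc k))
    ≡⟨ cong₂ (λ u v → u + suc n C suc k + v) ([k+1]*[n+1]C[k+1]≡[n+1]*nCk n k) ([k+1]*[n+1]C[k+1]≡[n+1]*nCk n (suc k)) ⟩
  suc n * (n C k) + suc n C suc k + suc n * (n C suc k)
    ≡⟨ cong (λ u → suc n * (n C k) + u + suc n * (n C suc k)) (sym (nCk+nC[k+1]≡[n+1]C[k+1] n k)) ⟩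
  suc n * (n C k) + (n C k + n C suc k) + suc n * (n C suc k)
    ≡⟨ lemma₂ (suc n) (n C k) (n C suc k) ⟩
  suc (suc n) * (n C k + n C suc k)
    ≡⟨ cong (suc (suc n) *_) (nCk+nC[k+1]≡[n+1]C[k+1] n k) ⟩
  suc (suc n) * (suc n C suc k) ∎
  where
  open ≡-Reasoning
  lemma : ∀ k x y → suc k * (x + y) ≡ k * x + x + suc k * y
  lemma = solve-∀
  lemma₂ : ∀ n x y → n * x + (x + y) + n * y ≡ suc n * (x + y)
  lemma₂ = solve-∀

[n+1]*[2n+2]C[n+1]≡2[2n+1]*[2n]Cn : ∀ n → suc n * ((2 + 2 * n) C suc n) ≡ 2 * suc (2 * n) * (2 * n C n)
[n+1]*[2n+2]C[n+1]≡2[2n+1]*[2n]Cn n = *-cancelˡ-≡ _ _ (suc n) (begin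
  suc n * (suc n * (suc (suc N) C suc n))
    ≡⟨ cong (suc n *_) ([k+1]*[n+1]C[k+1]≡[n+1]*nCk (suc N) n) ⟩
  suc n * (suc (suc N) * (suc N C n))
    ≡⟨ cong (λ u → suc n * (suc (suc N) * u)) symmetry ⟩
  suc n * (suc (suc N) * (suc N C suc n))
    ≡⟨ x∙yz≈y∙xz (suc n) (suc (suc N)) (suc N C suc n) ⟩
  suc (suc N) * (suc n * (suc N C suc n))
    ≡⟨ cong (suc (suc N) *_) ([k+1]*[n+1]C[k+1]≡[n+1]*nCk N n) ⟩
  suc (suc N) * (suc N * (N C n))
    ≡⟨ lemma n (N C n) ⟩
  suc n * (2 * suc N * (N C n)) ∎)
  where
  open ≡-Reasoning
  N = 2 * n
  symmetry : suc N C n ≡ suc N C suc n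
  symmetry = trans (nCk≡nC[n∸k] (≤-trans (m≤m+n n (n + 0)) (n≤1+n N)))
                    (cong (suc N C_) (trans (cong (_∸ n) (split n)) (m+n∸m≡n n (suc n))))
    where split : ∀ n → suc (2 * n) ≡ n + suc n
          split = solve-∀
  lemma : ∀ n c → suc (suc (2 * n)) * (suc (2 * n) * c) ≡ suc n * (2 * suc (2 * n) * c)
  lemma = solve-∀

∑ : ℕ → (ℕ → ℕ) → ℕ
∑ zero f = 0
∑ (suc n) f = ∑ n f + f n

sum-map-upTo : ∀ f n → sum (List.map f (upTo n)) ≡ ∑ n f
sum-map-upTo f zero = refl
sum-map-upTo f (suc n) = begin
  sum (List.map f (upTo (suc n)))         ≡⟨ cong (λ xs → sum (List.map f xs)) (sym (upTo-∷ʳ n)) ⟩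
  sum (List.map f (upTo n ∷ʳ n))          ≡⟨ cong sum (map-++ f (upTo n) _) ⟩
  sum (List.map f (upTo n) ∷ʳ f n)        ≡⟨ sum-++ (List.map f (upTo n)) _ ⟩
  sum (List.map f (upTo n)) + (f n + 0)   ≡⟨ cong₂ _+_ (sum-map-upTo f n) (+-identityʳ (f n)) ⟩
  ∑ n f + f n                             ∎
  where open ≡-Reasoning

∑-vanishing : ∀ {n f} → (∀ {k} → k < n → f k ≡ 0) → ∑ n f ≡ 0
∑-vanishing {zero} eq = refl
∑-vanishing {suc n} eq = cong₂ _+_ (∑-vanishing (λ k<n → eq (m<n⇒m<1+n k<n))) (eq (n<1+n n))

∑-split : ∀ m n f → ∑ (m + n) f ≡ ∑ m f + ∑ n (λ k → f (m + k))
∑-split m zero f rewrite +-identityʳ m = sym (+-identityʳ (∑ m f))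
∑-split m (suc n) f rewrite +-suc m n =
  trans (cong (_+ f (m + n)) (∑-split m n f)) (+-assoc (∑ m f) _ (f (m + n)))

∑-+ : ∀ n f g → ∑ n (λ k → f k + g k) ≡ ∑ n f + ∑ n g
∑-+ zero f g = refl
∑-+ (suc n) f g = trans (cong (_+ (f n + g n)) (∑-+ n f g)) (+-interchange (∑ n f) _ (f n) (g n))
  where +-interchange : ∀ a b c d → a + b + (c + d) ≡ a + c + (b + d)
        +-interchange = solve-∀

∑-*ˡ : ∀ n c f → ∑ n (λ k → c * f k) ≡ c * ∑ n f
∑-*ˡ zero c f = sym (*-zeroʳ c)
∑-*ˡ (suc n) c f = trans (cong (_+ c * f n) (∑-*ˡ n c f)) (sym (*-distribˡ-+ c (∑ n f) (f n)))

∑-telescope : ∀ {n} (f g h : ℕ → ℕ) → (∀ {k} → k < n → f k + h k ≡ g k + h (suc k)) → ∑ n f + h 0 ≡ ∑ n g + h n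
∑-telescope {zero} f g h step = refl
∑-telescope {suc n} f g h step = begin
  ∑ n f + f n + h 0          ≡⟨ swap (∑ n f) (f n) (h 0) ⟩
  ∑ n f + h 0 + f n          ≡⟨ cong (_+ f n) (∑-telescope f g h (λ k<n → step (m<n⇒m<1+n k<n))) ⟩
  ∑ n g + h n + f n          ≡⟨ swap′ (∑ n g) (h n) (f n) ⟩
  ∑ n g + (f n + h n)        ≡⟨ cong (_+_ (∑ n g)) (step (n<1+n n)) ⟩
  ∑ n g + (g n + h (suc n))  ≡⟨ sym (+-assoc (∑ n g) (g n) (h (suc n))) ⟩
  ∑ n g + g n + h (suc n)    ∎
  where
  open ≡-Reasoning
  swap : ∀ a b c → a + b + c ≡ a + c + b
  swap = solve-∀
  swap′ : ∀ a b c → a + b + c ≡ a + (c + b)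
  swap′ = solve-∀

-- The Boros–Moll recurrence

term : ℕ → ℕ → ℕ
term m k = 2 ^ k * ((2 * m ∸ 2 * k) C (m ∸ k)) * ((m + k) C k)

-- D i m = 4^m d_i(m)
D : ℕ → ℕ → ℕ
D i m = ∑ (suc m) (λ k → term m k * (k C i))

m+n≡o⇒o∸m≡n : ∀ {k r m} → k + r ≡ m → m ∸ k ≡ r
m+n≡o⇒o∸m≡n {k} {r} refl = m+n∸m≡n k r

m+n≡o⇒2o∸2m≡2n : ∀ {k r m} → k + r ≡ m → 2 * m ∸ 2 * k ≡ 2 * r
m+n≡o⇒2o∸2m≡2n {k} {r} refl = trans (cong (_∸ 2 * k) (*-distribˡ-+ 2 k r)) (m+n∸m≡n (2 * k) (2 * r))

term-suc : ∀ {m} k n → k + suc n ≡ m → suc k * suc (2 * n) * term m (suc k) ≡ suc (m + k) * suc n * term m k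
term-suc {m} k n eq = begin
  suc k * suc (2 * n) * term m (suc k)
    ≡⟨ cong₂ (λ u v → suc k * suc (2 * n) * (2 ^ suc k * u * v)) central′ (cong (_C suc k) (+-suc m k)) ⟩
  suc k * suc (2 * n) * (2 ^ suc k * (2 * n C n) * (suc (m + k) C suc k))
    ≡⟨ lemma₁ (suc k) n (2 ^ k) (2 * n C n) (suc (m + k) C suc k) ⟩
  2 ^ k * (2 * suc (2 * n) * (2 * n C n)) * (suc k * (suc (m + k) C suc k))
    ≡⟨ cong₂ (λ u v → 2 ^ k * u * v) (sym ([n+1]*[2n+2]C[n+1]≡2[2n+1]*[2n]Cn n)) ([k+1]*[n+1]C[k+1]≡[n+1]*nCk (m + k) k) ⟩
  2 ^ k * (suc n * ((2 + 2 * n) C suc n)) * (suc (m + k) * ((m + k) C k))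
    ≡⟨ lemma₂ (2 ^ k) (suc n) ((2 + 2 * n) C suc n) (suc (m + k)) ((m + k) C k) ⟩
  suc (m + k) * suc n * (2 ^ k * ((2 + 2 * n) C suc n) * ((m + k) C k))
    ≡⟨ cong (λ u → suc (m + k) * suc n * (2 ^ k * u * ((m + k) C k))) (sym central) ⟩
  suc (m + k) * suc n * term m k ∎
  where
  open ≡-Reasoning
  eq′ : suc k + n ≡ m
  eq′ = trans (sym (+-suc k n)) eq
  central : (2 * m ∸ 2 * k) C (m ∸ k) ≡ (2 + 2 * n) C suc n
  central = cong₂ _C_ (trans (m+n≡o⇒2o∸2m≡2n {k} eq) (*-suc 2 n)) (m+n≡o⇒o∸m≡n {k} eq)
  central′ : (2 * m ∸ 2 * suc k) C (m ∸ suc k) ≡ 2 * n C n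
  central′ = cong₂ _C_ (m+n≡o⇒2o∸2m≡2n {suc k} eq′) (m+n≡o⇒o∸m≡n {suc k} eq′)
  lemma₁ : ∀ k n p c b → k * suc (2 * n) * (2 * p * c * b) ≡ p * (2 * suc (2 * n) * c) * (k * b)
  lemma₁ = solve-∀
  lemma₂ : ∀ p n c q b → p * (n * c) * (q * b) ≡ q * n * (p * c * b)
  lemma₂ = solve-∀

[a+1]*[kCa+kC[a+1]]≡[k+1]*kCa : ∀ k a → suc a * (k C a + k C suc a) ≡ suc k * (k C a)
[a+1]*[kCa+kC[a+1]]≡[k+1]*kCa k a =
  trans (cong (suc a *_) (nCk+nC[k+1]≡[n+1]C[k+1] k a)) ([k+1]*[n+1]C[k+1]≡[n+1]*nCk k a)

-- The two sides differ by (a+1) times [a+1]*[kCa+kC[a+1]]≡[k+1]*kCa at a + 1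
-- minus (k+a+1) times the same identity at a.
binomial-three-term : ∀ k a → k * suc k * (k C a) + suc a * suc (suc a) * (k C suc (suc a))
                   ≡ 2 * suc a * k * (k C suc a) + a * suc a * (k C a)
binomial-three-term k a = +-cancelʳ-≡ K _ _ (begin
  k * suc k * x + suc a * suc (suc a) * z + K
    ≡⟨ certificate a k x y z ⟩
  2 * suc a * k * y + a * suc a * x + (suc a * (suc (suc a) * (y + z)) + (k + suc a) * (suc k * x))
    ≡⟨ cong₂ (λ u v → 2 * suc a * k * y + a * suc a * x + (suc a * u + (k + suc a) * v))
             ([a+1]*[kCa+kC[a+1]]≡[k+1]*kCa k (suc a)) (sym ([a+1]*[kCa+kC[a+1]]≡[k+1]*kCa k a)) ⟩
  2 * suc a * k * y + a * suc a * x + K ∎)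
  where
  open ≡-Reasoning
  x = k C a
  y = k C suc a
  z = k C suc (suc a)
  K = suc a * (suc k * y) + (k + suc a) * (suc a * (x + y))
  certificate : ∀ a k x y z →
    k * suc k * x + suc a * suc (suc a) * z + (suc a * (suc k * y) + (k + suc a) * (suc a * (x + y)))
    ≡ 2 * suc a * k * y + a * suc a * x + (suc a * (suc (suc a) * (y + z)) + (k + suc a) * (suc k * x))
  certificate = solve-∀

m[m+1]-split : ∀ a s {m} → a + s ≡ m → suc (m + a) * s + a * suc a ≡ m * suc m
m[m+1]-split a s refl = lemma a s
  where lemma : ∀ a s → suc (a + s + a) * s + a * suc a ≡ (a + s) * suc (a + s)
        lemma = solve-∀

-- Adding k(k+1)·C(k,a) to both sides turns each into m(m+1)·C(k,a) + (a+1)(2m+1)·C(k,a+1).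
column-identity : ∀ {m a s k r} → a + s ≡ m → k + r ≡ m →
  suc (m + a) * s * (k C a) + suc a * suc (suc a) * (k C suc (suc a)) + suc a * suc (2 * r) * (k C suc a)
  ≡ suc a * suc (2 * m) * (k C suc a) + suc (m + k) * r * (k C a)
column-identity {m} {a} {s} {k} {r} a+s≡m k+r≡m = +-cancelʳ-≡ (k * suc k * x) _ _ (trans lhs (sym rhs))
  where
  open ≡-Reasoning
  x = k C a
  y = k C suc a
  z = k C suc (suc a)
  lhs : suc (m + a) * s * x + suc a * suc (suc a) * z + suc a * suc (2 * r) * y + k * suc k * x
        ≡ m * suc m * x + suc a * suc (2 * m) * y
  lhs = begin
    suc (m + a) * s * x + suc a * suc (suc a) * z + suc a * suc (2 * r) * y + k * suc k * x
      ≡⟨ regroup m a s k r x y z ⟩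
    suc (m + a) * s * x + suc a * suc (2 * r) * y + (k * suc k * x + suc a * suc (suc a) * z)
      ≡⟨ cong (_+_ (suc (m + a) * s * x + suc a * suc (2 * r) * y)) (binomial-three-term k a) ⟩
    suc (m + a) * s * x + suc a * suc (2 * r) * y + (2 * suc a * k * y + a * suc a * x)
      ≡⟨ collect m a s k r x y ⟩
    (suc (m + a) * s + a * suc a) * x + suc a * suc (2 * (k + r)) * y
      ≡⟨ cong₂ (λ u v → u * x + suc a * suc (2 * v) * y) (m[m+1]-split a s a+s≡m) k+r≡m ⟩
    m * suc m * x + suc a * suc (2 * m) * y ∎
    where
    regroup : ∀ m a s k r x y z →
      suc (m + a) * s * x + suc a * suc (suc a) * z + suc a * suc (2 * r) * y + k * suc k * x
      ≡ suc (m + a) * s * x + suc a * suc (2 * r) * y + (k * suc k * x + suc a * suc (suc a) * z)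
    regroup = solve-∀
    collect : ∀ m a s k r x y →
      suc (m + a) * s * x + suc a * suc (2 * r) * y + (2 * suc a * k * y + a * suc a * x)
      ≡ (suc (m + a) * s + a * suc a) * x + suc a * suc (2 * (k + r)) * y
    collect = solve-∀
  rhs : suc a * suc (2 * m) * y + suc (m + k) * r * x + k * suc k * x
        ≡ m * suc m * x + suc a * suc (2 * m) * y
  rhs = trans (collect (suc a * suc (2 * m)) (suc (m + k)) r k x y)
              (cong (λ u → u * x + suc a * suc (2 * m) * y) (m[m+1]-split k r k+r≡m))
    where
    collect : ∀ c n r k x y → c * y + n * r * x + k * suc k * x ≡ (n * r + k * suc k) * x + c * y
    collect = solve-∀

module _ {m a s : ℕ} (a+s≡m : a + s ≡ m) where
  private
    -- L k and R k are the two sides of the recurrence at summand k, and G is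
    -- Zeilberger's certificate: L - R telescopes to G.
    F : ℕ → ℕ → ℕ
    F i k = term m k * (k C i)

    L R G : ℕ → ℕ
    L k = suc (m + a) * s * F a k + suc a * suc (suc a) * F (suc (suc a)) k
    R k = suc a * suc (2 * m) * F (suc a) k
    G k = suc a * suc (2 * (m ∸ k)) * F (suc a) k

    per-term : ∀ {k r} → k + r ≡ m → L k + G k ≡ R k + suc (m + k) * r * F a k
    per-term {k} {r} k+r≡m = begin
      L k + G k
        ≡⟨ cong (λ u → L k + suc a * suc (2 * u) * F (suc a) k) (m+n≡o⇒o∸m≡n {k} k+r≡m) ⟩
      L k + suc a * suc (2 * r) * F (suc a) k
        ≡⟨ factor (suc (m + a) * s) (suc a * suc (suc a)) (suc a * suc (2 * r)) (term m k) (k C a) (k C suc (suc a)) (k C suc a) ⟩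
      term m k * (suc (m + a) * s * (k C a) + suc a * suc (suc a) * (k C suc (suc a)) + suc a * suc (2 * r) * (k C suc a))
        ≡⟨ cong (term m k *_) (column-identity {m} {a} {s} {k} {r} a+s≡m k+r≡m) ⟩
      term m k * (suc a * suc (2 * m) * (k C suc a) + suc (m + k) * r * (k C a))
        ≡⟨ distribute (suc a * suc (2 * m)) (suc (m + k) * r) (term m k) (k C suc a) (k C a) ⟩
      R k + suc (m + k) * r * F a k ∎
      where
      open ≡-Reasoning
      factor : ∀ c j d t x z y → c * (t * x) + j * (t * z) + d * (t * y) ≡ t * (c * x + j * z + d * y)
      factor = solve-∀
      distribute : ∀ e f t y x → t * (e * y + f * x) ≡ e * (t * y) + f * (t * x)
      distribute = solve-∀

    G-suc : ∀ {k n} → k + suc n ≡ m → suc (m + k) * suc n * F a k ≡ G (suc k)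
    G-suc {k} {n} k+1+n≡m = begin
      suc (m + k) * suc n * (term m k * (k C a))
        ≡⟨ sym (*-assoc (suc (m + k) * suc n) (term m k) (k C a)) ⟩
      suc (m + k) * suc n * term m k * (k C a)
        ≡⟨ cong (_* (k C a)) (sym (term-suc k n k+1+n≡m)) ⟩
      suc k * suc (2 * n) * term m (suc k) * (k C a)
        ≡⟨ rearrange (suc k) (suc (2 * n)) (term m (suc k)) (k C a) ⟩
      suc (2 * n) * term m (suc k) * (suc k * (k C a))
        ≡⟨ cong (suc (2 * n) * term m (suc k) *_) (sym ([k+1]*[n+1]C[k+1]≡[n+1]*nCk k a)) ⟩
      suc (2 * n) * term m (suc k) * (suc a * (suc k C suc a))
        ≡⟨ rearrange′ (suc (2 * n)) (term m (suc k)) (suc a) (suc k C suc a) ⟩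
      suc a * suc (2 * n) * F (suc a) (suc k)
        ≡⟨ cong (λ u → suc a * suc (2 * u) * F (suc a) (suc k))
                (sym (m+n≡o⇒o∸m≡n {suc k} (trans (sym (+-suc k n)) k+1+n≡m))) ⟩
      G (suc k) ∎
      where
      open ≡-Reasoning
      rearrange : ∀ k c t x → k * c * t * x ≡ c * t * (k * x)
      rearrange = solve-∀
      rearrange′ : ∀ c t i x → c * t * (i * x) ≡ i * c * (t * x)
      rearrange′ = solve-∀

    step : ∀ {k} → k < m → L k + G k ≡ R k + G (suc k)
    step {k} k<m with m≤n⇒∃[o]m+o≡n k<m
    ... | n , k+1+n≡m = trans (per-term {k} k+suc-n≡m) (cong (_+_ (R k)) (G-suc {k} k+suc-n≡m))
      where k+suc-n≡m = trans (+-suc k n) k+1+n≡m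

    last : L m + G m ≡ R m
    last = begin
      L m + G m                            ≡⟨ per-term {m} {0} (+-identityʳ m) ⟩
      R m + suc (m + m) * 0 * F a m        ≡⟨ cong (λ u → R m + u * F a m) (*-zeroʳ (suc (m + m))) ⟩
      R m + 0                              ≡⟨ +-identityʳ (R m) ⟩
      R m                                  ∎
      where open ≡-Reasoning

    G₀≡0 : G 0 ≡ 0
    G₀≡0 = trans (cong (λ u → suc a * suc (2 * m) * (term m 0 * u)) (k>n⇒nCk≡0 {0} {suc a} (s≤s z≤n)))
                 (trans (cong (suc a * suc (2 * m) *_) (*-zeroʳ (term m 0))) (*-zeroʳ (suc a * suc (2 * m))))

  D-recurrence : suc (m + a) * s * D a m + suc a * suc (suc a) * D (suc (suc a)) m
                  ≡ suc a * suc (2 * m) * D (suc a) m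
  D-recurrence = begin
    suc (m + a) * s * D a m + suc a * suc (suc a) * D (suc (suc a)) m
      ≡⟨ sym (cong₂ _+_ (∑-*ˡ (suc m) (suc (m + a) * s) (F a)) (∑-*ˡ (suc m) (suc a * suc (suc a)) (F (suc (suc a))))) ⟩
    ∑ (suc m) (λ k → suc (m + a) * s * F a k) + ∑ (suc m) (λ k → suc a * suc (suc a) * F (suc (suc a)) k)
      ≡⟨ sym (∑-+ (suc m) _ _) ⟩
    ∑ m L + L m
      ≡⟨ cong (_+ L m) (sym (trans (cong (_+_ (∑ m L)) G₀≡0) (+-identityʳ (∑ m L)))) ⟩
    ∑ m L + G 0 + L m
      ≡⟨ cong (_+ L m) (∑-telescope L R G step) ⟩
    ∑ m R + G m + L m
      ≡⟨ regroup (∑ m R) (G m) (L m) ⟩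
    ∑ m R + (L m + G m)
      ≡⟨ cong (_+_ (∑ m R)) last ⟩
    ∑ (suc m) R
      ≡⟨ ∑-*ˡ (suc m) (suc a * suc (2 * m)) (F (suc a)) ⟩
    suc a * suc (2 * m) * D (suc a) m ∎
    where
    open ≡-Reasoning
    regroup : ∀ x g l → x + g + l ≡ x + (l + g)
    regroup = solve-∀

summand-vanishes : ∀ {m i k} → k < i → term m k * (k C i) ≡ 0
summand-vanishes {m} {i} {k} k<i = trans (cong (term m k *_) (k>n⇒nCk≡0 k<i)) (*-zeroʳ (term m k))

D-vanishes : ∀ {m i} → m < i → D i m ≡ 0
D-vanishes m<i = ∑-vanishing (λ k≤m → summand-vanishes (≤-<-trans (s≤s⁻¹ k≤m) m<i))

sumFromTo≡D : ∀ {m i} → i ≤ suc m → sumFromTo i m (λ k → term m k * (k C i)) ≡ D i m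
sumFromTo≡D {m} {i} i≤1+m = begin
  sumFromTo i m f
    ≡⟨ sum-map-upTo (λ t → f (i + t)) (suc m ∸ i) ⟩
  ∑ (suc m ∸ i) (λ t → f (i + t))
    ≡⟨ cong (_+ ∑ (suc m ∸ i) (λ t → f (i + t))) (sym (∑-vanishing {i} {f} summand-vanishes)) ⟩
  ∑ i f + ∑ (suc m ∸ i) (λ t → f (i + t))
    ≡⟨ sym (∑-split i (suc m ∸ i) f) ⟩
  ∑ (i + (suc m ∸ i)) f
    ≡⟨ cong (λ n → ∑ n f) (m+[n∸m]≡n i≤1+m) ⟩
  D i m ∎
  where
  open ≡-Reasoning
  f = λ k → term m k * (k C i)

-- Polynomial identities by normalisation

private variable n : ℕ

infixl 6 _⊕_
infixl 7 _⊗_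

data Expr (n : ℕ) : Set where
  var : Fin n → Expr n
  con : ℕ → Expr n
  _⊕_ _⊗_ : Expr n → Expr n → Expr n

eval : {A : Set} → (ℕ → A) → (A → A → A) → (A → A → A) → Expr n → Vec A n → A
eval # _+_ _*_ (var i) ρ = lookup ρ i
eval # _+_ _*_ (con c) ρ = # c
eval # _+_ _*_ (e ⊕ f) ρ = eval # _+_ _*_ e ρ + eval # _+_ _*_ f ρ
eval # _+_ _*_ (e ⊗ f) ρ = eval # _+_ _*_ e ρ * eval # _+_ _*_ f ρ

⟦_⟧ : Expr n → Vec ℕ n → ℕ
⟦_⟧ = eval (λ c → c) _+_ _*_

⟦_⟧ℤ : Expr n → Vec ℤ n → ℤ
⟦_⟧ℤ = eval +_ ℤ._+_ ℤ._*_

pos-⟦⟧ : ∀ (e : Expr n) ρ → + ⟦ e ⟧ ρ ≡ ⟦ e ⟧ℤ (Vec.map +_ ρ)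
pos-⟦⟧ (var i) ρ = sym (lookup-map i +_ ρ)
pos-⟦⟧ (con c) ρ = refl
pos-⟦⟧ (e ⊕ f) ρ = trans (ℤ.pos-+ (⟦ e ⟧ ρ) (⟦ f ⟧ ρ)) (cong₂ ℤ._+_ (pos-⟦⟧ e ρ) (pos-⟦⟧ f ρ))
pos-⟦⟧ (e ⊗ f) ρ = trans (ℤ.pos-* (⟦ e ⟧ ρ) (⟦ f ⟧ ρ)) (cong₂ ℤ._*_ (pos-⟦⟧ e ρ) (pos-⟦⟧ f ρ))

-- Dense normal forms: a polynomial in x₀, …, xₙ₋₁ is the list of its
-- coefficients in x₀, each a polynomial in the remaining variables.
Nf : ℕ → Set
Nf zero = ℕ
Nf (suc n) = List (Nf n)

⟦_⟧N : Nf n → Vec ℕ n → ℕ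
⟦_⟧N {zero} c [] = c
⟦_⟧N {suc n} [] ρ = 0
⟦_⟧N {suc n} (p ∷ ps) (x ∷ ρ) = ⟦ p ⟧N ρ + x * ⟦ ps ⟧N (x ∷ ρ)

conN : ℕ → Nf n
conN {zero} c = c
conN {suc n} c = conN c ∷ []

varN : Fin n → Nf n
varN {suc n} Fin.zero = conN 0 ∷ conN 1 ∷ []
varN {suc n} (Fin.suc i) = varN i ∷ []

infixl 6 _+N_
infixl 7 _*N_

_+N_ : Nf n → Nf n → Nf n
_+N_ {zero} p q = p + q
_+N_ {suc n} [] qs = qs
_+N_ {suc n} (p ∷ ps) [] = p ∷ ps
_+N_ {suc n} (p ∷ ps) (q ∷ qs) = p +N q ∷ ps +N qs

_*N_ : Nf n → Nf n → Nf n
_*N_ {zero} p q = p * q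
_*N_ {suc n} [] qs = []
_*N_ {suc n} (p ∷ ps) qs = List.map (p *N_) qs +N (conN 0 ∷ ps *N qs)

normalise : Expr n → Nf n
normalise (var i) = varN i
normalise (con c) = conN c
normalise (e ⊕ f) = normalise e +N normalise f
normalise (e ⊗ f) = normalise e *N normalise f

_==N_ : Nf n → Nf n → Bool
_==N_ {zero} p q = p ≡ᵇ q
_==N_ {suc n} [] [] = true
_==N_ {suc n} [] (q ∷ qs) = (conN 0 ==N q) ∧ ([] ==N qs)
_==N_ {suc n} (p ∷ ps) [] = (p ==N conN 0) ∧ (ps ==N [])
_==N_ {suc n} (p ∷ ps) (q ∷ qs) = (p ==N q) ∧ (ps ==N qs)

⟦conN⟧ : ∀ c (ρ : Vec ℕ n) → ⟦ conN c ⟧N ρ ≡ c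
⟦conN⟧ {zero} c [] = refl
⟦conN⟧ {suc n} c (x ∷ ρ) = trans (cong₂ _+_ (⟦conN⟧ c ρ) (*-zeroʳ x)) (+-identityʳ c)

⟦varN⟧ : ∀ (i : Fin n) ρ → ⟦ varN i ⟧N ρ ≡ lookup ρ i
⟦varN⟧ Fin.zero (x ∷ ρ) rewrite ⟦conN⟧ 0 ρ | ⟦conN⟧ 1 ρ = lemma x
  where lemma : ∀ x → x * (1 + x * 0) ≡ x
        lemma = solve-∀
⟦varN⟧ (Fin.suc i) (x ∷ ρ) = trans (cong₂ _+_ (⟦varN⟧ i ρ) (*-zeroʳ x)) (+-identityʳ _)

⟦+N⟧ : ∀ (p q : Nf n) ρ → ⟦ p +N q ⟧N ρ ≡ ⟦ p ⟧N ρ + ⟦ q ⟧N ρ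
⟦+N⟧ {zero} p q [] = refl
⟦+N⟧ {suc n} [] q ρ = refl
⟦+N⟧ {suc n} (p ∷ ps) [] ρ = sym (+-identityʳ _)
⟦+N⟧ {suc n} (p ∷ ps) (q ∷ qs) (x ∷ ρ) =
  trans (cong₂ (λ u v → u + x * v) (⟦+N⟧ p q ρ) (⟦+N⟧ ps qs (x ∷ ρ)))
        (lemma (⟦ p ⟧N ρ) (⟦ q ⟧N ρ) x (⟦ ps ⟧N (x ∷ ρ)) (⟦ qs ⟧N (x ∷ ρ)))
  where lemma : ∀ a b x c d → a + b + x * (c + d) ≡ a + x * c + (b + x * d)
        lemma = solve-∀

mutual
  ⟦*N⟧ : ∀ (p q : Nf n) ρ → ⟦ p *N q ⟧N ρ ≡ ⟦ p ⟧N ρ * ⟦ q ⟧N ρ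
  ⟦*N⟧ {zero} p q [] = refl
  ⟦*N⟧ {suc n} [] q ρ = refl
  ⟦*N⟧ {suc n} (p ∷ ps) qs (x ∷ ρ) = begin
    ⟦ List.map (p *N_) qs +N (conN 0 ∷ ps *N qs) ⟧N (x ∷ ρ)
      ≡⟨ ⟦+N⟧ (List.map (p *N_) qs) (conN 0 ∷ ps *N qs) (x ∷ ρ) ⟩
    ⟦ List.map (p *N_) qs ⟧N (x ∷ ρ) + (⟦ conN {n} 0 ⟧N ρ + x * ⟦ ps *N qs ⟧N (x ∷ ρ))
      ≡⟨ cong₂ (λ u v → u + (v + x * ⟦ ps *N qs ⟧N (x ∷ ρ))) (⟦scale⟧ p qs x ρ) (⟦conN⟧ 0 ρ) ⟩
    P * Q + (0 + x * ⟦ ps *N qs ⟧N (x ∷ ρ))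
      ≡⟨ cong (λ u → P * Q + x * u) (⟦*N⟧ ps qs (x ∷ ρ)) ⟩
    P * Q + x * (⟦ ps ⟧N (x ∷ ρ) * Q)
      ≡⟨ lemma P x (⟦ ps ⟧N (x ∷ ρ)) Q ⟩
    (P + x * ⟦ ps ⟧N (x ∷ ρ)) * Q ∎
    where
    open ≡-Reasoning
    P = ⟦ p ⟧N ρ
    Q = ⟦ qs ⟧N (x ∷ ρ)
    lemma : ∀ a x b c → a * c + x * (b * c) ≡ (a + x * b) * c
    lemma = solve-∀

  ⟦scale⟧ : ∀ (p : Nf n) qs x ρ → ⟦ List.map (p *N_) qs ⟧N (x ∷ ρ) ≡ ⟦ p ⟧N ρ * ⟦ qs ⟧N (x ∷ ρ)
  ⟦scale⟧ p [] x ρ = sym (*-zeroʳ (⟦ p ⟧N ρ))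
  ⟦scale⟧ p (q ∷ qs) x ρ =
    trans (cong₂ (λ u v → u + x * v) (⟦*N⟧ p q ρ) (⟦scale⟧ p qs x ρ))
          (lemma (⟦ p ⟧N ρ) (⟦ q ⟧N ρ) x (⟦ qs ⟧N (x ∷ ρ)))
    where lemma : ∀ a b x c → a * b + x * (a * c) ≡ a * (b + x * c)
          lemma = solve-∀

⟦normalise⟧ : ∀ (e : Expr n) ρ → ⟦ normalise e ⟧N ρ ≡ ⟦ e ⟧ ρ
⟦normalise⟧ (var i) ρ = ⟦varN⟧ i ρ
⟦normalise⟧ (con c) ρ = ⟦conN⟧ c ρ
⟦normalise⟧ (e ⊕ f) ρ = trans (⟦+N⟧ (normalise e) _ ρ) (cong₂ _+_ (⟦normalise⟧ e ρ) (⟦normalise⟧ f ρ))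
⟦normalise⟧ (e ⊗ f) ρ = trans (⟦*N⟧ (normalise e) _ ρ) (cong₂ _*_ (⟦normalise⟧ e ρ) (⟦normalise⟧ f ρ))

==N-sound : ∀ (p q : Nf n) → T (p ==N q) → ∀ ρ → ⟦ p ⟧N ρ ≡ ⟦ q ⟧N ρ
==N-sound {zero} p q eq [] = ≡ᵇ⇒≡ p q eq
==N-sound {suc n} [] [] eq ρ = refl
==N-sound {suc n} [] (q ∷ qs) eq (x ∷ ρ) =
  trans (sym (*-zeroʳ x))
        (cong₂ (λ u v → u + x * v) (trans (sym (⟦conN⟧ 0 ρ)) (==N-sound (conN 0) q (proj₁ both) ρ))
                                   (==N-sound [] qs (proj₂ both) (x ∷ ρ)))
  where both = Equivalence.to T-∧ eq
==N-sound {suc n} (p ∷ ps) [] eq (x ∷ ρ) =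
  trans (cong₂ (λ u v → u + x * v) (trans (==N-sound p (conN 0) (proj₁ both) ρ) (⟦conN⟧ 0 ρ))
                                   (==N-sound ps [] (proj₂ both) (x ∷ ρ)))
        (*-zeroʳ x)
  where both = Equivalence.to T-∧ eq
==N-sound {suc n} (p ∷ ps) (q ∷ qs) eq (x ∷ ρ) =
  cong₂ (λ u v → u + x * v) (==N-sound p q (proj₁ both) ρ) (==N-sound ps qs (proj₂ both) (x ∷ ρ))
  where both = Equivalence.to T-∧ eq

poly-identity : ∀ (e f : Expr n) → T (normalise e ==N normalise f) → ∀ ρ → ⟦ e ⟧ ρ ≡ ⟦ f ⟧ ρ
poly-identity e f eq ρ =
  trans (sym (⟦normalise⟧ e ρ)) (trans (==N-sound (normalise e) (normalise f) eq ρ) (⟦normalise⟧ f ρ))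

-- The bound ν/δ and the downward induction

â t̂ : Expr 2
â = var Fin.zero
t̂ = var (Fin.suc Fin.zero)

-- With j = a + 1 and m = j + t the coefficient of the theorem is ν a t / δ a t.
-- The polynomials are written as syntax so that identities between them are
-- decided by poly-identity; its decision argument _ is solved by evaluation.
ν̂ δ̂ σ̂ : Expr 2 → Expr 2 → Expr 2
ν̂ a t = con 204 ⊕ con 165 ⊗ t ⊕ con 32 ⊗ t ⊗ t ⊕ con 516 ⊗ a ⊕ con 306 ⊗ a ⊗ t ⊕ con 40 ⊗ a ⊗ t ⊗ t
      ⊕ con 464 ⊗ a ⊗ a ⊕ con 169 ⊗ a ⊗ a ⊗ t ⊕ con 8 ⊗ a ⊗ a ⊗ t ⊗ t ⊕ con 176 ⊗ a ⊗ a ⊗ a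
      ⊕ con 28 ⊗ a ⊗ a ⊗ a ⊗ t ⊕ con 24 ⊗ a ⊗ a ⊗ a ⊗ a
δ̂ a t = con 2 ⊗ (con 3 ⊕ a) ⊗ (con 11 ⊕ con 6 ⊗ a ⊕ con 4 ⊗ t) ⊗ (con 1 ⊕ t) ⊗ (con 2 ⊕ con 2 ⊗ a ⊕ t)
σ̂ a t = con 30104 ⊕ con 40556 ⊗ t ⊕ con 18572 ⊗ t ⊗ t ⊕ con 3600 ⊗ t ⊗ t ⊗ t ⊕ con 256 ⊗ t ⊗ t ⊗ t ⊗ t
      ⊕ con 89724 ⊗ a ⊕ con 108108 ⊗ a ⊗ t ⊕ con 42832 ⊗ a ⊗ t ⊗ t ⊕ con 6904 ⊗ a ⊗ t ⊗ t ⊗ t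
      ⊕ con 384 ⊗ a ⊗ t ⊗ t ⊗ t ⊗ t ⊕ con 106336 ⊗ a ⊗ a ⊕ con 111083 ⊗ a ⊗ a ⊗ t
      ⊕ con 35677 ⊗ a ⊗ a ⊗ t ⊗ t ⊕ con 4184 ⊗ a ⊗ a ⊗ t ⊗ t ⊗ t ⊕ con 128 ⊗ a ⊗ a ⊗ t ⊗ t ⊗ t ⊗ t
      ⊕ con 64820 ⊗ a ⊗ a ⊗ a ⊕ con 57078 ⊗ a ⊗ a ⊗ a ⊗ t ⊕ con 13734 ⊗ a ⊗ a ⊗ a ⊗ t ⊗ t
      ⊕ con 944 ⊗ a ⊗ a ⊗ a ⊗ t ⊗ t ⊗ t ⊕ con 21576 ⊗ a ⊗ a ⊗ a ⊗ a ⊕ con 15587 ⊗ a ⊗ a ⊗ a ⊗ a ⊗ t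
      ⊕ con 2493 ⊗ a ⊗ a ⊗ a ⊗ a ⊗ t ⊗ t ⊕ con 64 ⊗ a ⊗ a ⊗ a ⊗ a ⊗ t ⊗ t ⊗ t
      ⊕ con 3736 ⊗ a ⊗ a ⊗ a ⊗ a ⊗ a ⊕ con 2160 ⊗ a ⊗ a ⊗ a ⊗ a ⊗ a ⊗ t
      ⊕ con 176 ⊗ a ⊗ a ⊗ a ⊗ a ⊗ a ⊗ t ⊗ t ⊕ con 264 ⊗ a ⊗ a ⊗ a ⊗ a ⊗ a ⊗ a
      ⊕ con 120 ⊗ a ⊗ a ⊗ a ⊗ a ⊗ a ⊗ a ⊗ t

ν δ σ : ℕ → ℕ → ℕ
ν a t = ⟦ ν̂ â t̂ ⟧ (a ∷ t ∷ [])
δ a t = ⟦ δ̂ â t̂ ⟧ (a ∷ t ∷ [])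
σ a t = ⟦ σ̂ â t̂ ⟧ (a ∷ t ∷ [])

base-identity : ∀ a → suc (suc a + a) * 1 * ν a 0 ≡ suc a * suc (2 * suc a) * δ a 0 + 12 * suc a * suc a * suc a
base-identity a = poly-identity
  ((con 1 ⊕ (con 1 ⊕ â ⊕ â)) ⊗ con 1 ⊗ ν̂ â (con 0))
  ((con 1 ⊕ â) ⊗ (con 1 ⊕ con 2 ⊗ (con 1 ⊕ â)) ⊗ δ̂ â (con 0) ⊕ con 12 ⊗ (con 1 ⊕ â) ⊗ (con 1 ⊕ â) ⊗ (con 1 ⊕ â))
  _ (a ∷ 0 ∷ [])

δ-split : ∀ a t → δ a (suc t) ≡ 2 * (3 + a) * (15 + 6 * a + 4 * t) * (suc (suc (a + suc t) + a) * suc (suc t))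
δ-split a t = poly-identity
  (δ̂ â (con 1 ⊕ t̂))
  (con 2 ⊗ (con 3 ⊕ â) ⊗ (con 15 ⊕ con 6 ⊗ â ⊕ con 4 ⊗ t̂) ⊗ ((con 1 ⊕ (con 1 ⊕ (â ⊕ (con 1 ⊕ t̂)) ⊕ â)) ⊗ (con 1 ⊕ (con 1 ⊕ t̂))))
  _ (a ∷ t ∷ [])

step-identity : ∀ a t → let E = 2 * (3 + a) * (15 + 6 * a + 4 * t) in
  ν a (suc t) * ν (suc a) t + suc a * suc (suc a) * E * δ (suc a) t
  ≡ suc a * suc (2 * suc (a + suc t)) * E * ν (suc a) t + σ a t
step-identity a t = poly-identity
  (ν̂ â (con 1 ⊕ t̂) ⊗ ν̂ (con 1 ⊕ â) t̂ ⊕ (con 1 ⊕ â) ⊗ (con 1 ⊕ (con 1 ⊕ â)) ⊗ Ê ⊗ δ̂ (con 1 ⊕ â) t̂)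
  ((con 1 ⊕ â) ⊗ (con 1 ⊕ con 2 ⊗ (con 1 ⊕ (â ⊕ (con 1 ⊕ t̂)))) ⊗ Ê ⊗ ν̂ (con 1 ⊕ â) t̂ ⊕ σ̂ â t̂)
  _ (a ∷ t ∷ [])
  where Ê = con 2 ⊗ (con 3 ⊕ â) ⊗ (con 15 ⊕ con 6 ⊗ â ⊕ con 4 ⊗ t̂)

ratio-bound-base : ∀ {X Y p q n d} .{{_ : NonZero p}} → p * X ≡ q * Y → q * d ≤ p * n → X * d ≤ n * Y
ratio-bound-base {X} {Y} {p} {q} {n} {d} pX≡qY qd≤pn = *-cancelˡ-≤ p (begin
  p * (X * d)    ≡⟨ sym (*-assoc p X d) ⟩
  p * X * d      ≡⟨ cong (_* d) pX≡qY ⟩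
  q * Y * d      ≡⟨ lemma₁ q Y d ⟩
  Y * (q * d)    ≤⟨ *-monoʳ-≤ Y qd≤pn ⟩
  Y * (p * n)    ≡⟨ lemma₂ Y p n ⟩
  p * (n * Y)    ∎)
  where
  open ≤-Reasoning
  lemma₁ : ∀ q y d → q * y * d ≡ y * (q * d)
  lemma₁ = solve-∀
  lemma₂ : ∀ y p n → y * (p * n) ≡ p * (n * y)
  lemma₂ = solve-∀

ratio-bound-step : ∀ {X Y Z c j w E n₁ n₂ d₂} .{{_ : NonZero n₂}} →
  c * X + j * Z ≡ w * Y → Y * d₂ ≤ n₂ * Z → w * E * n₂ ≤ n₁ * n₂ + j * E * d₂ → X * (E * c) ≤ n₁ * Y
ratio-bound-step {X} {Y} {Z} {c} {j} {w} {E} {n₁} {n₂} {d₂} recurrence bound slack =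
  *-cancelʳ-≤ _ _ n₂ (+-cancelʳ-≤ (j * E * (Y * d₂)) _ _ (begin
    X * (E * c) * n₂ + j * E * (Y * d₂)   ≤⟨ +-monoʳ-≤ (X * (E * c) * n₂) (*-monoʳ-≤ (j * E) bound) ⟩
    X * (E * c) * n₂ + j * E * (n₂ * Z)   ≡⟨ lemma₁ X E c n₂ j Z ⟩
    E * n₂ * (c * X + j * Z)              ≡⟨ cong (E * n₂ *_) recurrence ⟩
    E * n₂ * (w * Y)                      ≡⟨ lemma₂ E n₂ w Y ⟩
    Y * (w * E * n₂)                      ≤⟨ *-monoʳ-≤ Y slack ⟩
    Y * (n₁ * n₂ + j * E * d₂)            ≡⟨ lemma₃ Y n₁ n₂ j E d₂ ⟩
    n₁ * Y * n₂ + j * E * (Y * d₂)        ∎))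
  where
  open ≤-Reasoning
  lemma₁ : ∀ X E c n j Z → X * (E * c) * n + j * E * (n * Z) ≡ E * n * (c * X + j * Z)
  lemma₁ = solve-∀
  lemma₂ : ∀ E n w Y → E * n * (w * Y) ≡ Y * (w * E * n)
  lemma₂ = solve-∀
  lemma₃ : ∀ Y n₁ n₂ j E d → Y * (n₁ * n₂ + j * E * d) ≡ n₁ * Y * n₂ + j * E * (Y * d)
  lemma₃ = solve-∀

D-ratio-bound-top : ∀ a → D a (suc a) * δ a 0 ≤ ν a 0 * D (suc a) (suc a)
D-ratio-bound-top a =
  ratio-bound-base {X = D a (suc a)} {Y = D (suc a) (suc a)}
                   {p = suc (suc a + a) * 1} {q = suc a * suc (2 * suc a)} {n = ν a 0} {d = δ a 0}
    recurrence
    (≤-trans (m≤m+n (suc a * suc (2 * suc a) * δ a 0) (12 * suc a * suc a * suc a))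
             (≤-reflexive (sym (base-identity a))))
  where
  recurrence : suc (suc a + a) * 1 * D a (suc a) ≡ suc a * suc (2 * suc a) * D (suc a) (suc a)
  recurrence = begin
    suc (suc a + a) * 1 * D a (suc a)
      ≡⟨ sym (+-identityʳ _) ⟩
    suc (suc a + a) * 1 * D a (suc a) + 0
      ≡⟨ cong (_+_ (suc (suc a + a) * 1 * D a (suc a))) (sym (*-zeroʳ (suc a * suc (suc a)))) ⟩
    suc (suc a + a) * 1 * D a (suc a) + suc a * suc (suc a) * 0
      ≡⟨ cong (λ u → suc (suc a + a) * 1 * D a (suc a) + suc a * suc (suc a) * u) (sym (D-vanishes (n<1+n (suc a)))) ⟩
    suc (suc a + a) * 1 * D a (suc a) + suc a * suc (suc a) * D (suc (suc a)) (suc a)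
      ≡⟨ D-recurrence {suc a} {a} {1} (+-comm a 1) ⟩
    suc a * suc (2 * suc a) * D (suc a) (suc a) ∎
    where open ≡-Reasoning

D-ratio-bound : ∀ t a {m} → suc a + t ≡ m → D a m * δ a t ≤ ν a t * D (suc a) m
D-ratio-bound zero a eq =
  subst (λ m → D a m * δ a 0 ≤ ν a 0 * D (suc a) m) (trans (cong suc (sym (+-identityʳ a))) eq) (D-ratio-bound-top a)
D-ratio-bound (suc t) a refl =
  subst (λ d → D a (suc a + suc t) * d ≤ ν a (suc t) * D (suc a) (suc a + suc t)) (sym (δ-split a t))
    (ratio-bound-step {X = D a m} {Y = D (suc a) m} {Z = D (suc (suc a)) m}
                      {c = suc (m + a) * suc (suc t)} {j = suc a * suc (suc a)} {w = suc a * suc (2 * m)}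
                      {E = 2 * (3 + a) * (15 + 6 * a + 4 * t)} {n₁ = ν a (suc t)} {n₂ = ν (suc a) t} {d₂ = δ (suc a) t}
      (D-recurrence {m} {a} {suc (suc t)} (+-suc a (suc t)))
      (D-ratio-bound t (suc a) {m} (cong suc (sym (+-suc a t))))
      (≤-trans (m≤m+n _ (σ a t)) (≤-reflexive (sym (step-identity a t)))))
  where m = suc a + suc t

-- Passing to ℚ

toℚᵘ-/ₙ : ∀ p n .{{_ : NonZero n}} → toℚᵘ (p /ₙ n) ≃ᵘ p /ᵘ n
toℚᵘ-/ₙ p (suc n) = *≡* (begin
  ℚᵘ.↥ toℚᵘ q ℤ.* + suc n       ≡⟨ cong (ℤ._* + suc n) (↥ᵘ-toℚᵘ q) ⟩
  ↥ q ℤ.* + suc n              ≡⟨ cong (↥ q ℤ.*_) (sym (↧-/ p (suc n))) ⟩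
  ↥ q ℤ.* (↧ q ℤ.* g)          ≡⟨ lemma (↥ q) (↧ q) g ⟩
  ↥ q ℤ.* g ℤ.* ↧ q            ≡⟨ cong (ℤ._* ↧ q) (↥-/ p (suc n)) ⟩
  p ℤ.* ↧ q                    ≡⟨ cong (p ℤ.*_) (sym (↧ᵘ-toℚᵘ q)) ⟩
  p ℤ.* ℚᵘ.↧ toℚᵘ q             ∎)
  where
  open ≡-Reasoning
  q = p ℚ./ suc n
  g = gcd p (+ suc n)
  lemma : ∀ u v g → u ℤ.* (v ℤ.* g) ≡ u ℤ.* g ℤ.* v
  lemma = ℤ-Solver.solve-∀

1/K*S/1≃S/K : ∀ S K .{{_ : NonZero K}} → (+ 1 /ᵘ K) ℚᵘ.* (S /ᵘ 1) ≃ᵘ S /ᵘ K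
1/K*S/1≃S/K S (suc K) = *≡* (lemma S (+ suc K))
  where lemma : ∀ x y → (+ 1 ℤ.* x) ℤ.* y ≡ x ℤ.* (y ℤ.* + 1)
        lemma = ℤ-Solver.solve-∀

[pα/e-w]/g≃n/r : ∀ (p w : ℕ) (α n : ℤ) (e g r : ℕ) .{{_ : NonZero e}} .{{_ : NonZero g}} .{{_ : NonZero r}} →
  (+ p ℤ.* α ℤ.- + w ℤ.* + e) ℤ.* + r ≡ n ℤ.* (+ e ℤ.* + g) →
  ((+ p /ᵘ 1) ℚᵘ.* (α /ᵘ e) ℚᵘ.- (+ w /ᵘ 1)) ℚᵘ.* (+ 1 /ᵘ g) ≃ᵘ n /ᵘ r
[pα/e-w]/g≃n/r p w α n (suc e) (suc g) (suc r) eq =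
  *≡* (trans (lemma₁ (+ p) α (+ w) (+ suc e) (+ suc r)) (trans eq (lemma₂ n (+ suc e) (+ suc g))))
  where
  lemma₁ : ∀ p α w e r → ((p ℤ.* α) ℤ.* + 1 ℤ.+ (ℤ.- w) ℤ.* (+ 1 ℤ.* e)) ℤ.* + 1 ℤ.* r ≡ (p ℤ.* α ℤ.- w ℤ.* e) ℤ.* r
  lemma₁ = ℤ-Solver.solve-∀
  lemma₂ : ∀ n e g → n ℤ.* (e ℤ.* g) ≡ n ℤ.* ((+ 1 ℤ.* e) ℤ.* + 1 ℤ.* g)
  lemma₂ = ℤ-Solver.solve-∀

/ᵘ-≤-*/ᵘ : ∀ {X Y n d K} .{{_ : NonZero d}} .{{_ : NonZero K}} →
           X * d ≤ n * Y → + X /ᵘ K ≤ᵘ (+ n /ᵘ d) ℚᵘ.* (+ Y /ᵘ K)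
/ᵘ-≤-*/ᵘ {X} {Y} {n} {suc d} {suc K} Xd≤nY = *≤* (subst₂ ℤ._≤_
  (ℤ.pos-* X (suc d * suc K))
  (trans (ℤ.pos-* (n * Y) (suc K)) (cong (ℤ._* + suc K) (ℤ.pos-* n Y)))
  (ℤ.+≤+ (subst (_≤ n * Y * suc K) (*-assoc X (suc d) (suc K)) (*-monoˡ-≤ (suc K) Xd≤nY))))

toℚᵘ-d : ∀ {i m} .{{_ : NonZero (2 ^ (2 * m))}} → i ≤ suc m → toℚᵘ (d i m) ≃ᵘ + D i m /ᵘ 2 ^ (2 * m)
toℚᵘ-d {i} {m} i≤1+m = begin-equality
  toℚᵘ (d i m)
    ≃⟨ toℚᵘ-homo-* (+ 1 /ₙ 2 ^ (2 * m)) (+ S /ₙ 1) ⟩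
  toℚᵘ (+ 1 /ₙ 2 ^ (2 * m)) ℚᵘ.* toℚᵘ (+ S /ₙ 1)
    ≃⟨ ℚᵘ.*-cong (toℚᵘ-/ₙ (+ 1) (2 ^ (2 * m))) (toℚᵘ-/ₙ (+ S) 1) ⟩
  (+ 1 /ᵘ 2 ^ (2 * m)) ℚᵘ.* (+ S /ᵘ 1)
    ≃⟨ 1/K*S/1≃S/K (+ S) (2 ^ (2 * m)) ⟩
  + S /ᵘ 2 ^ (2 * m)
    ≡⟨ cong (λ S → + S /ᵘ 2 ^ (2 * m)) (sumFromTo≡D i≤1+m) ⟩
  + D i m /ᵘ 2 ^ (2 * m) ∎
  where
  open ℚᵘ.≤-Reasoning
  S = sumFromTo i m (λ k → term m k * (k C i))

nonZero-+1 : ∀ n → NonZero (n + 1)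
nonZero-+1 n rewrite +-comm n 1 = _

-- (j+2)(4m+2j+5)(m-j+1) with j = a + 1 and m = j + t
κ̂ : Expr 2
κ̂ = (con 1 ⊕ â ⊕ con 2) ⊗ (con 4 ⊗ (con 1 ⊕ â ⊕ t̂) ⊕ con 2 ⊗ (con 1 ⊕ â) ⊕ con 5) ⊗ (t̂ ⊕ con 1)

κ : ℕ → ℕ → ℕ
κ a t = ⟦ κ̂ ⟧ (a ∷ t ∷ [])

-- At α = + a and τ = + t the left side is A (suc a + t) (suc a), definitionally.
numerator-identity : ∀ α τ → let M = + 1 ℤ.+ α ℤ.+ τ ; J = + 1 ℤ.+ α in
  + 30 ℤ.+ + 96 ℤ.* M ℤ.* M ℤ.+ + 94 ℤ.* M ℤ.+ + 37 ℤ.* J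
  ℤ.+ + 72 ℤ.* M ℤ.* M ℤ.* J ℤ.+ + 8 ℤ.* M ℤ.* M ℤ.* J ℤ.* J
  ℤ.- J ℤ.* J ℤ.* J ℤ.+ + 99 ℤ.* M ℤ.* J ℤ.+ + 5 ℤ.* J ℤ.* J
  ℤ.+ + 13 ℤ.* M ℤ.* J ℤ.* J ℤ.+ + 16 ℤ.* M ℤ.* M ℤ.* M ℤ.* J
  ℤ.+ + 32 ℤ.* M ℤ.* M ℤ.* M
  ≡ + 204 ℤ.+ + 165 ℤ.* τ ℤ.+ + 32 ℤ.* τ ℤ.* τ ℤ.+ + 516 ℤ.* α ℤ.+ + 306 ℤ.* α ℤ.* τ ℤ.+ + 40 ℤ.* α ℤ.* τ ℤ.* τ
    ℤ.+ + 464 ℤ.* α ℤ.* α ℤ.+ + 169 ℤ.* α ℤ.* α ℤ.* τ ℤ.+ + 8 ℤ.* α ℤ.* α ℤ.* τ ℤ.* τ ℤ.+ + 176 ℤ.* α ℤ.* α ℤ.* α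
    ℤ.+ + 28 ℤ.* α ℤ.* α ℤ.* α ℤ.* τ ℤ.+ + 24 ℤ.* α ℤ.* α ℤ.* α ℤ.* α
    ℤ.+ (+ 4 ℤ.* M ℤ.+ + 2 ℤ.* J ℤ.+ + 3) ℤ.* ((J ℤ.+ + 2) ℤ.* (+ 4 ℤ.* M ℤ.+ + 2 ℤ.* J ℤ.+ + 5) ℤ.* (τ ℤ.+ + 1))
numerator-identity = ℤ-Solver.solve-∀

A≡ν+Wκ : ∀ a t → A (suc a + t) (suc a) ≡ + (ν a t + (4 * (suc a + t) + 2 * suc a + 3) * κ a t)
A≡ν+Wκ a t = trans (numerator-identity (+ a) (+ t)) (sym (pos-⟦⟧ (ν̂ â t̂ ⊕ Ŵ ⊗ κ̂) (a ∷ t ∷ [])))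
  where
  Ŵ = con 4 ⊗ (con 1 ⊕ â ⊕ t̂) ⊕ con 2 ⊗ (con 1 ⊕ â) ⊕ con 3

κ*G≡δ : ∀ a t → κ a t * (2 * (suc a + t + suc a)) ≡ δ a t
κ*G≡δ a t = poly-identity (κ̂ ⊗ (con 2 ⊗ (con 1 ⊕ â ⊕ t̂ ⊕ (con 1 ⊕ â)))) (δ̂ â t̂) _ (a ∷ t ∷ [])

coefficient-identity : ∀ {p w e g k r n : ℕ} {α : ℤ} → α ≡ + (n + w * k) → e ≡ p * k → k * g ≡ r →
  (+ p ℤ.* α ℤ.- + w ℤ.* + e) ℤ.* + r ≡ + n ℤ.* (+ e ℤ.* + g)
coefficient-identity {p} {w} {e} {g} {k} {r} {n} refl refl refl = begin
  (+ p ℤ.* + (n + w * k) ℤ.- + w ℤ.* + (p * k)) ℤ.* + (k * g)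
    ≡⟨ cong₂ (λ u v → (+ p ℤ.* u ℤ.- + w ℤ.* v) ℤ.* + (k * g))
             (trans (ℤ.pos-+ n (w * k)) (cong (λ u → + n ℤ.+ u) (ℤ.pos-* w k))) (ℤ.pos-* p k) ⟩
  (+ p ℤ.* (+ n ℤ.+ + w ℤ.* + k) ℤ.- + w ℤ.* (+ p ℤ.* + k)) ℤ.* + (k * g)
    ≡⟨ cong ((+ p ℤ.* (+ n ℤ.+ + w ℤ.* + k) ℤ.- + w ℤ.* (+ p ℤ.* + k)) ℤ.*_) (ℤ.pos-* k g) ⟩
  (+ p ℤ.* (+ n ℤ.+ + w ℤ.* + k) ℤ.- + w ℤ.* (+ p ℤ.* + k)) ℤ.* (+ k ℤ.* + g)
    ≡⟨ lemma (+ p) (+ n) (+ w) (+ k) (+ g) ⟩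
  + n ℤ.* (+ p ℤ.* + k ℤ.* + g)
    ≡⟨ cong (λ u → + n ℤ.* (u ℤ.* + g)) (sym (ℤ.pos-* p k)) ⟩
  + n ℤ.* (+ (p * k) ℤ.* + g) ∎
  where
  open ≡-Reasoning
  lemma : ∀ p n w k g → (p ℤ.* (n ℤ.+ w ℤ.* k) ℤ.- w ℤ.* (p ℤ.* k)) ℤ.* (k ℤ.* g) ≡ n ℤ.* (p ℤ.* k ℤ.* g)
  lemma = ℤ-Solver.solve-∀

coeff≃ν/δ : ∀ a t → toℚᵘ (coeff (suc a + t) (suc a)) ≃ᵘ + ν a t /ᵘ δ a t
coeff≃ν/δ a t = begin-equality
  toℚᵘ (coeff m j)
    ≃⟨ toℚᵘ-homo-* (P ℚ.* B m j ℚ.- W) G ⟩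
  toℚᵘ (P ℚ.* B m j ℚ.- W) ℚᵘ.* toℚᵘ G
    ≃⟨ ℚᵘ.*-congʳ (toℚᵘ-homo-+ (P ℚ.* B m j) (ℚ.- W)) ⟩
  (toℚᵘ (P ℚ.* B m j) ℚᵘ.+ toℚᵘ (ℚ.- W)) ℚᵘ.* toℚᵘ G
    ≃⟨ ℚᵘ.*-congʳ (ℚᵘ.+-cong (toℚᵘ-homo-* P (B m j)) (toℚᵘ-homo‿- W)) ⟩
  (toℚᵘ P ℚᵘ.* toℚᵘ (B m j) ℚᵘ.- toℚᵘ W) ℚᵘ.* toℚᵘ G
    ≃⟨ ℚᵘ.*-cong (ℚᵘ.+-cong (ℚᵘ.*-cong (toℚᵘ-/ₙ _ 1) (toℚᵘ-/ₙ (A m j) E)) (ℚᵘ.-‿cong (toℚᵘ-/ₙ _ 1)))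
                  (toℚᵘ-/ₙ (+ 1) _) ⟩
  ((+ p /ᵘ 1) ℚᵘ.* (A m j /ᵘ E) ℚᵘ.- (+ w /ᵘ 1)) ℚᵘ.* (+ 1 /ᵘ (2 * (m + j)))
    ≃⟨ [pα/e-w]/g≃n/r p w (A m j) (+ ν a t) E (2 * (m + j)) (δ a t)
         (coefficient-identity {p} {w} {E} {2 * (m + j)} {κ a t} {δ a t} {ν a t} (A≡ν+Wκ a t) E≡p*κ (κ*G≡δ a t)) ⟩
  + ν a t /ᵘ δ a t ∎
  where
  open ℚᵘ.≤-Reasoning
  m = suc a + t
  j = suc a
  p = 2 * (m + 1)
  w = 4 * m + 2 * j + 3
  E = 2 * (j + 2) * (4 * m + 2 * j + 5) * (m + 1) * (m ∸ j + 1)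
  P W G : ℚ
  P = + p /ₙ 1
  W = + w /ₙ 1
  G = + 1 /ₙ (2 * (m + j))
  instance
    E≢0 : NonZero E
    E≢0 = m*n≢0 (2 * (j + 2) * (4 * m + 2 * j + 5) * (m + 1)) (m ∸ j + 1) {{_}} {{nonZero-+1 (m ∸ j)}}
  E≡p*κ : E ≡ p * κ a t
  E≡p*κ = trans (cong (λ u → 2 * (j + 2) * (4 * m + 2 * j + 5) * (m + 1) * (u + 1)) (m+n∸m≡n (suc a) t))
                (lemma m j t)
    where lemma : ∀ m j t → 2 * (j + 2) * (4 * m + 2 * j + 5) * (m + 1) * (t + 1)
                            ≡ 2 * (m + 1) * ((j + 2) * (4 * m + 2 * j + 5) * (t + 1))
          lemma = solve-∀

d-ratio-bound : ∀ a t → d a (suc a + t) ≤ℚ coeff (suc a + t) (suc a) *ℚ d (suc a) (suc a + t)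
d-ratio-bound a t = toℚᵘ-cancel-≤ (begin
  toℚᵘ (d a m)
    ≃⟨ toℚᵘ-d (≤-trans (m≤m+n a t) (≤-trans (n≤1+n _) (n≤1+n _))) ⟩
  + D a m /ᵘ 2 ^ (2 * m)
    ≤⟨ /ᵘ-≤-*/ᵘ (D-ratio-bound t a refl) ⟩
  (+ ν a t /ᵘ δ a t) ℚᵘ.* (+ D (suc a) m /ᵘ 2 ^ (2 * m))
    ≃⟨ ℚᵘ.*-cong (ℚᵘ.≃-sym (coeff≃ν/δ a t)) (ℚᵘ.≃-sym (toℚᵘ-d (s≤s (≤-trans (m≤m+n a t) (n≤1+n _))))) ⟩
  toℚᵘ (coeff m j) ℚᵘ.* toℚᵘ (d j m)
    ≃⟨ ℚᵘ.≃-sym (toℚᵘ-homo-* (coeff m j) (d j m)) ⟩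
  toℚᵘ (coeff m j ℚ.* d j m) ∎)
  where
  open ℚᵘ.≤-Reasoning
  m = suc a + t
  j = suc a
  instance
    4^m≢0 : NonZero (2 ^ (2 * m))
    4^m≢0 = m^n≢0 2 (2 * m)

lemma3p3 : (m : ℕ) → 2 ≤ m → (j : ℕ) → 1 ≤ j → j ≤ m → d (j ∸ 1) m ≤ℚ (coeff m j *ℚ d j m)
lemma3p3 m _ (suc a) _ j≤m =
  subst (λ m → d a m ≤ℚ coeff m (suc a) *ℚ d (suc a) m) (proj₂ split) (d-ratio-bound a (proj₁ split))
  where split = m≤n⇒∃[o]m+o≡n j≤m
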